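{- Let $r\ge 2$ and $n\ge m$ be positive integers. Then \[ \kappa_{r,2}(m,n) \le \left(1-\frac{1}{r}\right)\left(1+\frac{1}{n-1}\right)m. \]
   Context: $K_{m,n}$ denotes the complete bipartite graph with vertex classes $[m]$ and $[n]$. An $r$-edge-coloring is a map $c:E(K_{m,n})\to[r]$. A path is alternating if any two adjacent edges of it have different colors; the length of a path is its number of edges. Paths between two vertices are internally disjoint if they share no vertices other than their endpoints. $\kappa_{r,2}(m,n)$ is the maximum $t$ such that there is an $r$-edge-coloring of $K_{m,n}$ in which every pair of distinct vertices of the class $[n]$ is connected by $t$ internally disjoint alternating paths of length $2$. -}

module Defs where

open import Data.Nat using (ℕ)
open import Data.Fin using (Fin)
open import Data.Product using (Σ; _×_)
open import Relation.Binary.PropositionalEquality using (_≡_; _≢_)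
open import Function.Definitions using (Injective)

-- An r-edge-coloring of K_{m,n}: the edge between vertex i of class [m]
-- and vertex j of class [n] gets color c i j ∈ [r].
Coloring : ℕ → ℕ → ℕ → Set
Coloring r m n = Fin m → Fin n → Fin r

-- For u, v in class [n], a path of length 2 from u to v is u – w – v with
-- middle vertex w in class [m].  It is alternating iff its two edges
-- have different colors.
AltPath2 : ∀ {r m n} → Coloring r m n → Fin n → Fin n → Fin m → Set
AltPath2 c u v w = c w u ≢ c w v

-- u and v are connected by t internally disjoint alternating paths of
-- length 2: t such paths whose middle vertices are pairwise distinct
-- (length-2 paths are internally disjoint iff their middle vertices differ).
HasDisjointAltPaths : ∀ {r m n} → Coloring r m n → ℕ → Fin n → Fin n → Set
HasDisjointAltPaths {m = m} c t u v =
  Σ (Fin t → Fin m) λ mid → Injective _≡_ _≡_ mid × (∀ i → AltPath2 c u v (mid i))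

-- t is attainable in the definition of κ_{r,2}(m,n): some r-edge-coloring
-- in which every pair of distinct vertices of [n] has t such paths.
-- κ_{r,2}(m,n) is the maximum attainable t.
Attainable : ℕ → ℕ → ℕ → ℕ → Set
Attainable r m n t =
  Σ (Coloring r m n) λ c → ∀ (u v : Fin n) → u ≢ v → HasDisjointAltPaths c t u v

module Submission where

-- Double counting over the triples (w, u, v) with u ≠ v in [n] and c w u ≠ c w v: each of the
-- n(n - 1) ordered pairs (u, v) contributes at least t middle vertices w.  For a fixed w in [m],
-- if the colour classes of the edges at w have sizes a₁, …, a_r, the number of ordered pairs
-- (u, v) with c w u ≠ c w v is n² - Σ aₖ², and Cauchy–Schwarz gives Σ aₖ² ≥ n²/r.  Hence
-- t n (n - 1) ≤ m (1 - 1/r) n².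

open import Defs
open import Data.Nat using (ℕ; zero; suc; _+_; _*_; _∸_; _≤_; z≤n; s≤s)
open import Data.Nat.Properties
open import Algebra.Properties.Semiring.Sum +-*-semiring
  using (sum; sum-syntax; sum-cong-≗; sum-remove; ∑-distrib-+; ∑-comm; *-distribˡ-sum; *-distribʳ-sum)
open import Data.Nat.Solver using (module +-*-Solver)
open import Data.Fin using (Fin; zero; suc; punchIn; punchOut)
import Data.Fin.Properties as Fin
open import Data.Product using (_,_)
open import Data.Sum using (inj₁; inj₂)
open import Function using (_∘_)
open import Function.Definitions using (Injective)
open import Relation.Binary.PropositionalEquality
open import Relation.Nullary using (yes; no; contradiction)

open +-*-Solver

∑-const : ∀ n k → ∑[ i < n ] k ≡ n * k
∑-const zero    k = refl
∑-const (suc n) k = cong (k +_) (∑-const n k)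

∑-mono-≤ : ∀ {n} {f g : Fin n → ℕ} → (∀ i → f i ≤ g i) → sum f ≤ sum g
∑-mono-≤ {zero}  f≤g = z≤n
∑-mono-≤ {suc n} f≤g = +-mono-≤ (f≤g zero) (∑-mono-≤ (f≤g ∘ suc))

∑-injective-≤ : ∀ {t m} (f : Fin t → Fin m) → Injective _≡_ _≡_ f →
                (g : Fin m → ℕ) → ∑[ i < t ] g (f i) ≤ sum g
∑-injective-≤ {zero}          f f-inj g = z≤n
∑-injective-≤ {suc t} {zero}  f f-inj g with () ← f zero
∑-injective-≤ {suc t} {suc m} f f-inj g = begin
  g f₀ + ∑[ i < t ] g (f (suc i))            ≡⟨ cong (g f₀ +_) (sum-cong-≗ (cong g ∘ sym ∘ Fin.punchIn-punchOut ∘ f₀≢)) ⟩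
  g f₀ + ∑[ i < t ] g (punchIn f₀ (f′ i))    ≤⟨ +-monoʳ-≤ (g f₀) (∑-injective-≤ f′ f′-inj (g ∘ punchIn f₀)) ⟩
  g f₀ + ∑[ j < m ] g (punchIn f₀ j)         ≡⟨ sum-remove g ⟨
  sum g                                      ∎
  where
  open ≤-Reasoning
  f₀ = f zero
  f₀≢ : ∀ i → f₀ ≢ f (suc i)
  f₀≢ i eq with () ← f-inj eq
  f′ : Fin t → Fin m
  f′ i = punchOut (f₀≢ i)
  f′-inj : Injective _≡_ _≡_ f′
  f′-inj {i} {j} eq = Fin.suc-injective (f-inj (Fin.punchOut-injective (f₀≢ i) (f₀≢ j) eq))

2ab≤a²+b²-ordered : ∀ {a b} → a ≤ b → 2 * (a * b) ≤ a * a + b * b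
2ab≤a²+b²-ordered {a} a≤b with o , refl ← m≤n⇒∃[o]m+o≡n a≤b = subst (2 * (a * (a + o)) ≤_)
  (solve 2 (λ a o → con 2 :* (a :* (a :+ o)) :+ o :* o := a :* a :+ (a :+ o) :* (a :+ o)) refl a o)
  (m≤m+n _ (o * o))

2ab≤a²+b² : ∀ a b → 2 * (a * b) ≤ a * a + b * b
2ab≤a²+b² a b with ≤-total a b
... | inj₁ a≤b = 2ab≤a²+b²-ordered a≤b
... | inj₂ b≤a = subst₂ _≤_ (cong (2 *_) (*-comm b a)) (+-comm (b * b) (a * a)) (2ab≤a²+b²-ordered b≤a)

∑²≤r*∑sq : ∀ {r} (a : Fin r → ℕ) → sum a * sum a ≤ r * ∑[ k < r ] (a k * a k)
∑²≤r*∑sq {r} a = *-cancelˡ-≤ 2 (begin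
  2 * (sum a * sum a)                                  ≡⟨ cong (2 *_) ∑²≡∑∑ ⟩
  2 * ∑[ k < r ] ∑[ l < r ] (a k * a l)                ≡⟨ *-distribˡ-sum 2 (λ k → ∑[ l < r ] (a k * a l)) ⟩
  ∑[ k < r ] (2 * ∑[ l < r ] (a k * a l))              ≡⟨ sum-cong-≗ {r} (λ k → *-distribˡ-sum 2 (λ l → a k * a l)) ⟩
  ∑[ k < r ] ∑[ l < r ] (2 * (a k * a l))              ≤⟨ ∑-mono-≤ (λ k → ∑-mono-≤ (λ l → 2ab≤a²+b² (a k) (a l))) ⟩
  ∑[ k < r ] ∑[ l < r ] (a k * a k + a l * a l)        ≡⟨ sum-cong-≗ {r} (λ k → ∑-distrib-+ {r} _ _) ⟩
  ∑[ k < r ] (∑[ l < r ] (a k * a k) + Q)              ≡⟨ ∑-distrib-+ {r} _ _ ⟩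
  ∑[ k < r ] ∑[ l < r ] (a k * a k) + ∑[ k < r ] Q     ≡⟨ cong₂ _+_ (sum-cong-≗ {r} (λ k → ∑-const r _)) (∑-const r Q) ⟩
  ∑[ k < r ] (r * (a k * a k)) + r * Q                 ≡⟨ cong (_+ r * Q) (*-distribˡ-sum r (λ k → a k * a k)) ⟨
  r * Q + r * Q                                        ≡⟨ solve 2 (λ r q → r :* q :+ r :* q := con 2 :* (r :* q)) refl r Q ⟩
  2 * (r * Q)                                          ∎)
  where
  open ≤-Reasoning
  Q = ∑[ k < r ] (a k * a k)
  ∑²≡∑∑ : sum a * sum a ≡ ∑[ k < r ] ∑[ l < r ] (a k * a l)
  ∑²≡∑∑ = trans (*-distribʳ-sum (sum a) a) (sum-cong-≗ {r} (λ k → *-distribˡ-sum (a k) a))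

δ : ∀ {r} → Fin r → Fin r → ℕ
δ zero    zero    = 1
δ zero    (suc _) = 0
δ (suc _) zero    = 0
δ (suc a) (suc b) = δ a b

δᶜ : ∀ {r} → Fin r → Fin r → ℕ
δᶜ zero    zero    = 0
δᶜ zero    (suc _) = 1
δᶜ (suc _) zero    = 1
δᶜ (suc a) (suc b) = δᶜ a b

δ+δᶜ≡1 : ∀ {r} (a b : Fin r) → δ a b + δᶜ a b ≡ 1
δ+δᶜ≡1 zero    zero    = refl
δ+δᶜ≡1 zero    (suc b) = refl
δ+δᶜ≡1 (suc a) zero    = refl
δ+δᶜ≡1 (suc a) (suc b) = δ+δᶜ≡1 a b

δᶜ-refl : ∀ {r} (a : Fin r) → δᶜ a a ≡ 0
δᶜ-refl zero    = refl
δᶜ-refl (suc a) = δᶜ-refl a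

δᶜ-≢ : ∀ {r} {a b : Fin r} → a ≢ b → δᶜ a b ≡ 1
δᶜ-≢ {a = zero}  {zero}  a≢b = contradiction refl a≢b
δᶜ-≢ {a = zero}  {suc b} a≢b = refl
δᶜ-≢ {a = suc a} {zero}  a≢b = refl
δᶜ-≢ {a = suc a} {suc b} a≢b = δᶜ-≢ (a≢b ∘ cong suc)

δ*δ : ∀ {r} (a b k : Fin r) → δ a k * δ b k ≡ δ a b * δ a k
δ*δ zero    zero    zero    = refl
δ*δ zero    zero    (suc k) = refl
δ*δ zero    (suc b) zero    = refl
δ*δ zero    (suc b) (suc k) = refl
δ*δ (suc a) zero    zero    = refl
δ*δ (suc a) zero    (suc k) = *-zeroʳ (δ a k)
δ*δ (suc a) (suc b) zero    = sym (*-zeroʳ (δ a b))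
δ*δ (suc a) (suc b) (suc k) = δ*δ a b k

∑δ≡1 : ∀ {r} (a : Fin r) → ∑[ k < r ] δ a k ≡ 1
∑δ≡1 {suc r} zero    = cong suc (trans (∑-const r 0) (*-zeroʳ r))
∑δ≡1 {suc r} (suc a) = ∑δ≡1 a

∑δδ≡δ : ∀ {r} (a b : Fin r) → ∑[ k < r ] (δ a k * δ b k) ≡ δ a b
∑δδ≡δ {r} a b = begin
  ∑[ k < r ] (δ a k * δ b k)   ≡⟨ sum-cong-≗ {r} (δ*δ a b) ⟩
  ∑[ k < r ] (δ a b * δ a k)   ≡⟨ *-distribˡ-sum (δ a b) (δ a) ⟨
  δ a b * ∑[ k < r ] δ a k     ≡⟨ cong (δ a b *_) (∑δ≡1 a) ⟩
  δ a b * 1                    ≡⟨ *-identityʳ (δ a b) ⟩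
  δ a b                        ∎
  where open ≡-Reasoning

∑δᶜ : ∀ {n} (u : Fin n) → ∑[ v < n ] δᶜ u v ≡ n ∸ 1
∑δᶜ {suc n}       zero    = trans (∑-const n 1) (*-identityʳ n)
∑δᶜ {suc (suc n)} (suc u) = cong suc (∑δᶜ u)

module ColourClasses {n r} (col : Fin n → Fin r) where

  classSize : Fin r → ℕ
  classSize k = ∑[ u < n ] δ (col u) k

  monochromaticPairs : ℕ
  monochromaticPairs = ∑[ u < n ] ∑[ v < n ] δ (col u) (col v)

  bichromaticPairs : ℕ
  bichromaticPairs = ∑[ u < n ] ∑[ v < n ] δᶜ (col u) (col v)

  ∑classSize≡n : ∑[ k < r ] classSize k ≡ n
  ∑classSize≡n = begin
    ∑[ k < r ] ∑[ u < n ] δ (col u) k   ≡⟨ ∑-comm (λ k u → δ (col u) k) ⟩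
    ∑[ u < n ] ∑[ k < r ] δ (col u) k   ≡⟨ sum-cong-≗ {n} (∑δ≡1 ∘ col) ⟩
    ∑[ u < n ] 1                        ≡⟨ ∑-const n 1 ⟩
    n * 1                               ≡⟨ *-identityʳ n ⟩
    n                                   ∎
    where open ≡-Reasoning

  monochromatic+bichromatic : monochromaticPairs + bichromaticPairs ≡ n * n
  monochromatic+bichromatic = begin
    monochromaticPairs + bichromaticPairs
      ≡⟨ ∑-distrib-+ {n} (λ u → ∑[ v < n ] δ (col u) (col v)) _ ⟨
    ∑[ u < n ] (∑[ v < n ] δ (col u) (col v) + ∑[ v < n ] δᶜ (col u) (col v))
      ≡⟨ sum-cong-≗ {n} (λ u → ∑-distrib-+ {n} (λ v → δ (col u) (col v)) _) ⟨
    ∑[ u < n ] ∑[ v < n ] (δ (col u) (col v) + δᶜ (col u) (col v))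
      ≡⟨ sum-cong-≗ {n} (λ u → sum-cong-≗ {n} (λ v → δ+δᶜ≡1 (col u) (col v))) ⟩
    ∑[ u < n ] ∑[ v < n ] 1
      ≡⟨ sum-cong-≗ {n} (λ u → trans (∑-const n 1) (*-identityʳ n)) ⟩
    ∑[ u < n ] n
      ≡⟨ ∑-const n n ⟩
    n * n
      ∎
    where open ≡-Reasoning

  monochromatic≡∑classSize² : monochromaticPairs ≡ ∑[ k < r ] (classSize k * classSize k)
  monochromatic≡∑classSize² = begin
    ∑[ u < n ] ∑[ v < n ] δ (col u) (col v)
      ≡⟨ sum-cong-≗ {n} (λ u → sum-cong-≗ {n} (λ v → ∑δδ≡δ (col u) (col v))) ⟨
    ∑[ u < n ] ∑[ v < n ] ∑[ k < r ] (δ (col u) k * δ (col v) k)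
      ≡⟨ sum-cong-≗ {n} (λ u → ∑-comm (λ v k → δ (col u) k * δ (col v) k)) ⟩
    ∑[ u < n ] ∑[ k < r ] ∑[ v < n ] (δ (col u) k * δ (col v) k)
      ≡⟨ ∑-comm (λ u k → ∑[ v < n ] (δ (col u) k * δ (col v) k)) ⟩
    ∑[ k < r ] ∑[ u < n ] ∑[ v < n ] (δ (col u) k * δ (col v) k)
      ≡⟨ sum-cong-≗ {r} (λ k → sum-cong-≗ {n} (λ u → *-distribˡ-sum (δ (col u) k) (λ v → δ (col v) k))) ⟨
    ∑[ k < r ] ∑[ u < n ] (δ (col u) k * classSize k)
      ≡⟨ sum-cong-≗ {r} (λ k → *-distribʳ-sum (classSize k) (λ u → δ (col u) k)) ⟨
    ∑[ k < r ] (classSize k * classSize k)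
      ∎
    where open ≡-Reasoning

  r*bichromatic+n²≤r*n² : r * bichromaticPairs + n * n ≤ r * (n * n)
  r*bichromatic+n²≤r*n² = begin
    r * B + n * n                      ≡⟨ cong (λ s → r * B + s * s) ∑classSize≡n ⟨
    r * B + sum a * sum a              ≤⟨ +-monoʳ-≤ (r * B) (∑²≤r*∑sq a) ⟩
    r * B + r * ∑[ k < r ] (a k * a k) ≡⟨ cong (λ M → r * B + r * M) monochromatic≡∑classSize² ⟨
    r * B + r * M                      ≡⟨ *-distribˡ-+ r B M ⟨
    r * (B + M)                        ≡⟨ cong (r *_) (trans (+-comm B M) monochromatic+bichromatic) ⟩
    r * (n * n)                        ∎
    where
    open ≤-Reasoning
    a = classSize
    B = bichromaticPairs
    M = monochromaticPairs

module _ {r m n} (c : Coloring r m n) where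

  open ColourClasses using (bichromaticPairs)

  alternatingMiddles : Fin n → Fin n → ℕ
  alternatingMiddles u v = ∑[ w < m ] δᶜ (c w u) (c w v)

  disjointAltPaths⇒≤alternatingMiddles : ∀ {t u v} → HasDisjointAltPaths c t u v →
                                         t ≤ alternatingMiddles u v
  disjointAltPaths⇒≤alternatingMiddles {t} {u} {v} (mid , mid-inj , alt) = begin
    t                                              ≡⟨ trans (∑-const t 1) (*-identityʳ t) ⟨
    ∑[ i < t ] 1                                   ≡⟨ sum-cong-≗ {t} (sym ∘ δᶜ-≢ ∘ alt) ⟩
    ∑[ i < t ] δᶜ (c (mid i) u) (c (mid i) v)      ≤⟨ ∑-injective-≤ mid mid-inj (λ w → δᶜ (c w u) (c w v)) ⟩
    alternatingMiddles u v                         ∎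
    where open ≤-Reasoning

  ∑alternatingMiddles≡∑bichromatic :
    ∑[ u < n ] ∑[ v < n ] alternatingMiddles u v ≡ ∑[ w < m ] bichromaticPairs (c w)
  ∑alternatingMiddles≡∑bichromatic = begin
    ∑[ u < n ] ∑[ v < n ] ∑[ w < m ] δᶜ (c w u) (c w v)
      ≡⟨ sum-cong-≗ {n} (λ u → ∑-comm (λ v w → δᶜ (c w u) (c w v))) ⟩
    ∑[ u < n ] ∑[ w < m ] ∑[ v < n ] δᶜ (c w u) (c w v)
      ≡⟨ ∑-comm (λ u w → ∑[ v < n ] δᶜ (c w u) (c w v)) ⟩
    ∑[ w < m ] bichromaticPairs (c w)
      ∎
    where open ≡-Reasoning

  module _ {t} (paths : ∀ u v → u ≢ v → HasDisjointAltPaths c t u v) where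

    t*δᶜ≤alternatingMiddles : ∀ u v → t * δᶜ u v ≤ alternatingMiddles u v
    t*δᶜ≤alternatingMiddles u v with u Fin.≟ v
    ... | yes refl = subst (_≤ alternatingMiddles u u) (sym (trans (cong (t *_) (δᶜ-refl u)) (*-zeroʳ t))) z≤n
    ... | no u≢v   = subst (_≤ alternatingMiddles u v) (sym (trans (cong (t *_) (δᶜ-≢ u≢v)) (*-identityʳ t)))
                       (disjointAltPaths⇒≤alternatingMiddles (paths u v u≢v))

    t*orderedPairs≤∑bichromatic : t * (n * (n ∸ 1)) ≤ ∑[ w < m ] bichromaticPairs (c w)
    t*orderedPairs≤∑bichromatic = begin
      t * (n * (n ∸ 1))                            ≡⟨ cong (t *_) (∑-const n (n ∸ 1)) ⟨
      t * ∑[ u < n ] (n ∸ 1)                       ≡⟨ cong (t *_) (sum-cong-≗ {n} ∑δᶜ) ⟨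
      t * ∑[ u < n ] ∑[ v < n ] δᶜ u v             ≡⟨ *-distribˡ-sum t (λ u → ∑[ v < n ] δᶜ u v) ⟩
      ∑[ u < n ] (t * ∑[ v < n ] δᶜ u v)           ≡⟨ sum-cong-≗ {n} (λ u → *-distribˡ-sum t (δᶜ u)) ⟩
      ∑[ u < n ] ∑[ v < n ] (t * δᶜ u v)           ≤⟨ ∑-mono-≤ (λ u → ∑-mono-≤ (t*δᶜ≤alternatingMiddles u)) ⟩
      ∑[ u < n ] ∑[ v < n ] alternatingMiddles u v ≡⟨ ∑alternatingMiddles≡∑bichromatic ⟩
      ∑[ w < m ] bichromaticPairs (c w)            ∎
      where open ≤-Reasoning

lemma2p2 : (r m n : ℕ) → 2 ≤ r → 1 ≤ m → m ≤ n →
    (t : ℕ) → Attainable r m n t →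
    t * r * (n ∸ 1) ≤ (r ∸ 1) * n * m
lemma2p2 r m zero _ _ _ t _ = subst (_≤ (r ∸ 1) * 0 * m) (sym (*-zeroʳ (t * r))) z≤n
lemma2p2 (suc r′) m n@(suc n′) (s≤s _) _ _ t (c , paths) = *-cancelʳ-≤ _ _ n (begin
  t * r * n′ * n                          ≡⟨ solve 4 (λ t r n′ n → t :* r :* n′ :* n := r :* (t :* (n :* n′))) refl t r n′ n ⟩
  r * (t * (n * n′))                      ≤⟨ *-monoʳ-≤ r (t*orderedPairs≤∑bichromatic c paths) ⟩
  r * ∑[ w < m ] bichromaticPairs (c w)   ≡⟨ *-distribˡ-sum r (bichromaticPairs ∘ c) ⟩
  ∑[ w < m ] (r * bichromaticPairs (c w)) ≤⟨ ∑-mono-≤ r*bichromatic≤ ⟩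
  ∑[ w < m ] (r′ * (n * n))               ≡⟨ ∑-const m (r′ * (n * n)) ⟩
  m * (r′ * (n * n))                      ≡⟨ solve 3 (λ m r′ n → m :* (r′ :* (n :* n)) := r′ :* n :* m :* n) refl m r′ n ⟩
  r′ * n * m * n                          ∎)
  where
  open ≤-Reasoning
  open ColourClasses using (bichromaticPairs; r*bichromatic+n²≤r*n²)
  r = suc r′
  r*bichromatic≤ : ∀ w → r * bichromaticPairs (c w) ≤ r′ * (n * n)
  r*bichromatic≤ w = +-cancelʳ-≤ (n * n) _ _
    (≤-trans (r*bichromatic+n²≤r*n² (c w)) (≤-reflexive (+-comm (n * n) (r′ * (n * n)))))
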